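{- Let $\Pi$ be a WALT deduction of $\Gamma;\Delta;\mathcal{E}\vdash M:A$. Let $\Gamma_F$ be the set of type assignments obtained from every assignment $x:B$ occurring in $\Gamma$, in $\Delta$, or in some component $\Theta_i$ or $\Phi_i$ of a pair $(\Theta_i;\Phi_i)\in\mathcal{E}$, and let $A_F$ be obtained from $A$, by (i) replacing every occurrence of $\multimap$ and of $\multimap_{e}$ with the implication $\Rightarrow$ of System F, and (ii) erasing every occurrence of $!$ and $\$$. Then $\Gamma_F\vdash M:A_F$ is derivable in System F.
   Context: WALT (Weak Affine Light Typing) is the following type assignment system for pure $\lambda$-terms $M::=x\mid \lambda x.M\mid MN$. Formulas: $A::=L\mid !A\mid \$A$ and $L::=\alpha\mid A\multimap A\mid \$A\multimap_{e}A\mid \forall\alpha.L$ ($\alpha$ type variables; formulas generated by $L$ are called linear; $\multimap_e$ is a second linear implication). A type assignment is $x:A$; $\mathrm{dom}$ of a set of assignments is the set of its variables. Judgments are $\Gamma;\Delta;\mathcal{E}\vdash M:A$ where $\Gamma,\Delta$ are sets of type assignments and $\mathcal{E}$ is a finite set of pairs $(\Theta;\Phi)$, $\Theta$ a set of type assignments and $\Phi$ either empty or a singleton, with at most one pair having $\Phi=\emptyset$ and with the variables of distinct $\Phi$'s distinct; $\mathrm{dom}(\mathcal{E})$ is the union of the domains of all its $\Theta$'s and $\Phi$'s. $\mathcal{E}_M\sqcup\mathcal{E}_N$ is $\{(\Theta_M\cup\Theta_N;\Phi)\mid(\Theta_M;\Phi)\in\mathcal{E}_M,(\Theta_N;\Phi)\in\mathcal{E}_N\}$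 together with the pairs of $\mathcal{E}_M$ (resp. $\mathcal{E}_N$) whose second component is not the second component of any pair of $\mathcal{E}_N$ (resp. $\mathcal{E}_M$); $\mathcal{E}\sqcup\{(\emptyset;\emptyset)\}=\mathcal{E}\sqcup\emptyset=\mathcal{E}$. $\mathcal{E},(\Theta;\Phi)$ denotes $\mathcal{E}\cup\{(\Theta;\Phi)\}$ with $(\Theta;\Phi)\notin\mathcal{E}$; $\$\Delta$ denotes $\Delta$ with each type $B$ replaced by $\$B$. Except for second components $\Phi$ merged by $\sqcup$, the domains of sets of assignments coming from distinct premises of a rule must be disjoint. Rules: (A) $\Gamma,x:L;\Delta;\mathcal{E}\vdash x:L$ ($L$ linear). (C) from $\Gamma;\Delta;\mathcal{E},(\Theta_x;\{x:A\}),(\Theta_y;\{y:A\})\vdash M:B$ infer $\Gamma;\Delta;\mathcal{E}\sqcup\{(\Theta_x\cup\Theta_y;\{z:A\})\}\vdash M\{z/x,z/y\}:B$. ($\multimap I$) from $\Gamma,x:L;\Delta;\mathcal{E}\vdash M:B$ infer $\Gamma;\Delta;\mathcal{E}\vdash\lambda x.M:L\multimap B$. ($\multimap I_\$$) from $\Gamma;\Delta,x:A;\mathcal{E}\vdash M:B$ infer $\Gamma;\Delta;\mathcal{E}\vdash\lambda x.M:\$A\multimap B$. ($\multimap E$) from $\Gamma_M;\Delta_M;\mathcal{E}_M\vdash M:A\multimap B$ and $\Gamma_N;\Delta_N;\mathcal{E}_N\vdash N:A$, with $A$ not of the form $!C$, infer $\Gamma_M,\Gamma_N;\Delta_M,\Delta_N;\mathcal{E}_M\sqcup\mathcal{E}_N\vdash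 MN:B$. ($\multimap I_!$) from $\Gamma;\Delta;\mathcal{E},(\Theta;\{x:A\})\vdash M:B$ infer $\Gamma;\Delta;\mathcal{E}\sqcup\{(\Theta;\emptyset)\}\vdash\lambda x.M:!A\multimap B$. ($\multimap E_!$) from $\Gamma_M;\Delta_M;\mathcal{E}_M\vdash M:!A\multimap B$ and $\Gamma_N;\Delta_N;\mathcal{E}_N\vdash N:!A$, with every pair of $\mathcal{E}_M$ of the form $(\emptyset;\Phi)$, infer $\Gamma_M,\Gamma_N;\Delta_M,\Delta_N;\mathcal{E}_M\sqcup\mathcal{E}_N\vdash MN:B$. ($\multimap_e I$) from $\Gamma;\Delta;\mathcal{E},(\Theta\cup\{x:A\};\emptyset)\vdash M:B$ infer $\Gamma;\Delta;\mathcal{E}\sqcup\{(\Theta;\emptyset)\}\vdash\lambda x.M:\$A\multimap_e B$. ($\multimap_e E$) from $\Gamma_M;\Delta;\mathcal{E}_M\vdash M:\$A\multimap_e B$ and $\emptyset;\emptyset;\mathcal{E}_N\vdash N:\$A$ with $\mathcal{E}_N\subseteq\{(\Theta;\emptyset)\}$, infer $\Gamma_M;\Delta;\mathcal{E}_M\sqcup\mathcal{E}_N\vdash MN:B$. ($\$$) from $\Gamma;\Delta';\{(\Theta';\emptyset)\}\vdash M:B$ infer $\Gamma';\$\Delta',\Delta;\{(\$\Theta';\emptyset)\}\sqcup\{(\Theta_1;\Phi_1)\}\sqcup\dots\sqcup\{(\Theta_m;\Phi_m)\}\vdash M:\$B$ (any $\Gamma',\Delta$, $m\ge0$), provided $\Gamma\subseteq\Delta\cup\bigcup_i\Theta_i\cup\bigcup_i\Phi_i$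 and $\Theta_i\neq\emptyset$ iff $\Phi_i=\emptyset$. ($!$) from $\Gamma;\emptyset;\{(\Theta';\emptyset)\}\vdash M:B$ infer $\Gamma';\Delta;\{(\$\Theta';\emptyset)\}\sqcup\{(\Theta;\Phi)\}\vdash M:!B$ (any $\Gamma',\Delta$), provided $\Gamma\subseteq\Theta\cup\Phi$ and ($\Theta\neq\emptyset$ implies $\mathrm{dom}(\Phi)\cap FV(M)\neq\emptyset$). ($\forall I$) from $\Gamma;\Delta;\mathcal{E}\vdash M:L$ infer $\Gamma;\Delta;\mathcal{E}\vdash M:\forall\alpha.L$, $\alpha$ not free in $\Gamma,\Delta,\mathcal{E}$. ($\forall E$) from $\Gamma;\Delta;\mathcal{E}\vdash M:\forall\alpha.L$ infer $\Gamma;\Delta;\mathcal{E}\vdash M:L\{L'/\alpha\}$, $L'$ linear. -}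

module Defs where

open import Data.Nat using (ℕ; zero; suc; pred; _≡ᵇ_; _<ᵇ_; _≤_)
open import Data.Bool using (Bool; true; false; _∧_; _∨_; not; if_then_else_)
open import Data.Maybe using (Maybe; just; nothing; is-just; fromMaybe)
open import Data.List using (List; []; _∷_; _++_; map; filterᵇ; concatMap; foldl; length; [_])
open import Data.Bool.ListAction using (any)
open import Data.List.Membership.Propositional using (_∈_; _∉_)
open import Data.List.Relation.Binary.Subset.Propositional using (_⊆_)
open import Data.List.Relation.Binary.Permutation.Propositional using (_↭_)
open import Data.List.Relation.Binary.Pointwise using (Pointwise)
open import Data.List.Relation.Unary.All using (All)
open import Data.List.Relation.Unary.Unique.Propositional using (Unique)
open import Data.Product using (Σ; _×_; _,_; proj₁; proj₂; map₂)
open import Data.Sum using (_⊎_)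
open import Relation.Binary.PropositionalEquality using (_≡_; _≢_)

data Term : Set where
  var : ℕ → Term
  lam : ℕ → Term → Term
  app : Term → Term → Term

FV : Term → List ℕ
FV (var x)   = x ∷ []
FV (lam x M) = filterᵇ (λ y → not (y ≡ᵇ x)) (FV M)
FV (app M N) = FV M ++ FV N

BV : Term → List ℕ
BV (var x)   = []
BV (lam x M) = x ∷ BV M
BV (app M N) = BV M ++ BV N

-- ren xs z M = M{z/x₁,…,z/xₖ}: simultaneous replacement of the free
-- occurrences of the variables xs by z (not capture avoiding; it is
-- only used under the side condition that z is not bound in M).
ren : List ℕ → ℕ → Term → Term
ren xs z (var w)   = if any (λ v → v ≡ᵇ w) xs then var z else var w
ren xs z (lam w M) = lam w (ren (filterᵇ (λ v → not (v ≡ᵇ w)) xs) z M)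
ren xs z (app M N) = app (ren xs z M) (ren xs z N)

-- WALT formulas (type variables as de Bruijn indices)
--   A ::= L | !A | $A
--   L ::= α | A ⊸ A | $A ⊸e A | ∀α.L

data Ty : Set
data Lin : Set

data Ty where
  lin : Lin → Ty
  !_  : Ty → Ty
  $_  : Ty → Ty

data Lin where
  tv   : ℕ → Lin
  _⊸_  : Ty → Ty → Lin
  _⊸e_ : Ty → Ty → Lin    -- A ⊸e B  represents the formula  $A ⊸e B
  ∀L   : Lin → Lin

shiftT : ℕ → Ty → Ty
shiftL : ℕ → Lin → Lin
shiftT c (lin L) = lin (shiftL c L)
shiftT c (! A)   = ! shiftT c A
shiftT c ($ A)   = $ shiftT c A
shiftL c (tv n)   = if n <ᵇ c then tv n else tv (suc n)
shiftL c (A ⊸ B)  = shiftT c A ⊸ shiftT c B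
shiftL c (A ⊸e B) = shiftT c A ⊸e shiftT c B
shiftL c (∀L L)   = ∀L (shiftL (suc c) L)

substT : ℕ → Lin → Ty → Ty
substL : ℕ → Lin → Lin → Lin
substT j L' (lin L) = lin (substL j L' L)
substT j L' (! A)   = ! substT j L' A
substT j L' ($ A)   = $ substT j L' A
substL j L' (tv n)   = if n ≡ᵇ j then L' else (if j <ᵇ n then tv (pred n) else tv n)
substL j L' (A ⊸ B)  = substT j L' A ⊸ substT j L' B
substL j L' (A ⊸e B) = substT j L' A ⊸e substT j L' B
substL j L' (∀L L)   = ∀L (substL (suc j) (shiftL 0 L') L)

eqT : Ty → Ty → Bool
eqL : Lin → Lin → Bool
eqT (lin L) (lin L') = eqL L L'
eqT (! A)   (! B)    = eqT A B
eqT ($ A)   ($ B)    = eqT A B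
eqT _       _        = false
eqL (tv n)   (tv m)     = n ≡ᵇ m
eqL (A ⊸ B)  (A' ⊸ B')  = eqT A A' ∧ eqT B B'
eqL (A ⊸e B) (A' ⊸e B') = eqT A A' ∧ eqT B B'
eqL (∀L L)   (∀L L')    = eqL L L'
eqL _        _          = false

Asg : Set
Asg = ℕ × Ty

Ctx : Set
Ctx = List Asg

-- a pair (Θ ; Φ), Φ empty (nothing) or a singleton (just a)
EPair : Set
EPair = Ctx × Maybe Asg

ECtx : Set
ECtx = List EPair

maybeToList : {A : Set} → Maybe A → List A
maybeToList nothing  = []
maybeToList (just a) = a ∷ []

eqΦ : Maybe Asg → Maybe Asg → Bool
eqΦ nothing        nothing         = true
eqΦ (just (x , A)) (just (y , B))  = (x ≡ᵇ y) ∧ eqT A B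
eqΦ _              _               = false

findΘ : Maybe Asg → ECtx → Maybe Ctx
findΘ Φ []             = nothing
findΘ Φ ((Θ , Φ') ∷ E) = if eqΦ Φ Φ' then just Θ else findΘ Φ E

_⊔_ : ECtx → ECtx → ECtx
EM ⊔ EN =
  map (λ p → (proj₁ p ++ fromMaybe [] (findΘ (proj₂ p) EN) , proj₂ p)) EM
  ++ filterᵇ (λ p → not (is-just (findΘ (proj₂ p) EM))) EN

flatE : ECtx → Ctx
flatE = concatMap (λ p → proj₁ p ++ maybeToList (proj₂ p))

isNothing : Maybe Asg → Bool
isNothing nothing  = true
isNothing (just _) = false

WF : Ctx → Ctx → ECtx → Set
WF Γ Δ E = Unique (map proj₁ (Γ ++ Δ ++ flatE E))
         × length (filterᵇ (λ p → isNothing (proj₂ p)) E) ≤ 1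

$ctx : Ctx → Ctx
$ctx = map (map₂ $_)

shiftC : Ctx → Ctx
shiftC = map (map₂ (shiftT 0))

shiftE : ECtx → ECtx
shiftE = map (λ p → (shiftC (proj₁ p) , Data.Maybe.map (map₂ (shiftT 0)) (proj₂ p)))

-- WALT derivations  Γ ; Δ ; E ⊢ M : A
-- Sets are represented by lists; the rules ex-Γ, ex-Δ, ex-E, ex-Θ make
-- derivability independent of the order of the lists, and drop∅ / add∅
-- implement the convention that the pair (∅;∅) may be omitted.

data WALT : Ctx → Ctx → ECtx → Term → Ty → Set where
  ax : ∀ {Γ Δ E x L} → WF ((x , lin L) ∷ Γ) Δ E →
       WALT ((x , lin L) ∷ Γ) Δ E (var x) (lin L)
  contr : ∀ {Γ Δ E Θx Θy x y z A M B} →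
       WALT Γ Δ ((Θx , just (x , A)) ∷ (Θy , just (y , A)) ∷ E) M B →
       z ∉ BV M →
       WF Γ Δ (E ⊔ [ (Θx ++ Θy , just (z , A)) ]) →
       WALT Γ Δ (E ⊔ [ (Θx ++ Θy , just (z , A)) ]) (ren (x ∷ y ∷ []) z M) B
  ⊸I : ∀ {Γ Δ E x L M B} →
       WALT ((x , lin L) ∷ Γ) Δ E M B → WF Γ Δ E →
       WALT Γ Δ E (lam x M) (lin (lin L ⊸ B))
  ⊸I$ : ∀ {Γ Δ E x A M B} →
       WALT Γ ((x , A) ∷ Δ) E M B → WF Γ Δ E →
       WALT Γ Δ E (lam x M) (lin (($ A) ⊸ B))
  ⊸E : ∀ {ΓM ΔM EM ΓN ΔN EN M N A B} →
       WALT ΓM ΔM EM M (lin (A ⊸ B)) → WALT ΓN ΔN EN N A →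
       (∀ C → A ≢ (! C)) →
       WF (ΓM ++ ΓN) (ΔM ++ ΔN) (EM ⊔ EN) →
       WALT (ΓM ++ ΓN) (ΔM ++ ΔN) (EM ⊔ EN) (app M N) B
  ⊸I! : ∀ {Γ Δ E Θ x A M B} →
       WALT Γ Δ ((Θ , just (x , A)) ∷ E) M B →
       WF Γ Δ (E ⊔ [ (Θ , nothing) ]) →
       WALT Γ Δ (E ⊔ [ (Θ , nothing) ]) (lam x M) (lin ((! A) ⊸ B))
  ⊸E! : ∀ {ΓM ΔM EM ΓN ΔN EN M N A B} →
       WALT ΓM ΔM EM M (lin ((! A) ⊸ B)) → WALT ΓN ΔN EN N (! A) →
       All (λ p → proj₁ p ≡ []) EM →
       WF (ΓM ++ ΓN) (ΔM ++ ΔN) (EM ⊔ EN) →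
       WALT (ΓM ++ ΓN) (ΔM ++ ΔN) (EM ⊔ EN) (app M N) B
  ⊸eI : ∀ {Γ Δ E Θ x A M B} →
       WALT Γ Δ (((x , A) ∷ Θ , nothing) ∷ E) M B →
       WF Γ Δ (E ⊔ [ (Θ , nothing) ]) →
       WALT Γ Δ (E ⊔ [ (Θ , nothing) ]) (lam x M) (lin (A ⊸e B))
  ⊸eE : ∀ {ΓM Δ EM EN M N A B} →
       WALT ΓM Δ EM M (lin (A ⊸e B)) → WALT [] [] EN N ($ A) →
       (EN ≡ [] ⊎ Σ Ctx (λ Θ → EN ≡ [ (Θ , nothing) ])) →
       WF ΓM Δ (EM ⊔ EN) →
       WALT ΓM Δ (EM ⊔ EN) (app M N) B
  $R : ∀ {Γ Δ' Θ' M B} (Γ' Δ : Ctx) (Ps : ECtx) →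
       WALT Γ Δ' [ (Θ' , nothing) ] M B →
       All (λ p → (proj₁ p ≢ [] → proj₂ p ≡ nothing)
                × (proj₂ p ≡ nothing → proj₁ p ≢ [])) Ps →
       Γ ⊆ (Δ ++ flatE Ps) →
       WF Γ' ($ctx Δ' ++ Δ) (foldl _⊔_ [ ($ctx Θ' , nothing) ] (map [_] Ps)) →
       WALT Γ' ($ctx Δ' ++ Δ) (foldl _⊔_ [ ($ctx Θ' , nothing) ] (map [_] Ps)) M ($ B)
  !R : ∀ {Γ Θ' M B} (Γ' Δ Θ : Ctx) (Φ : Maybe Asg) →
       WALT Γ [] [ (Θ' , nothing) ] M B →
       Γ ⊆ (Θ ++ maybeToList Φ) →
       (Θ ≢ [] → Σ Asg (λ a → Φ ≡ just a × proj₁ a ∈ FV M)) →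
       WF Γ' Δ ([ ($ctx Θ' , nothing) ] ⊔ [ (Θ , Φ) ]) →
       WALT Γ' Δ ([ ($ctx Θ' , nothing) ] ⊔ [ (Θ , Φ) ]) M (! B)
  ∀I : ∀ {Γ Δ E M L} →
       WALT (shiftC Γ) (shiftC Δ) (shiftE E) M (lin L) → WF Γ Δ E →
       WALT Γ Δ E M (lin (∀L L))
  ∀E : ∀ {Γ Δ E M L} (L' : Lin) →
       WALT Γ Δ E M (lin (∀L L)) →
       WALT Γ Δ E M (lin (substL 0 L' L))
  ex-Γ : ∀ {Γ Γ' Δ E M A} → Γ ↭ Γ' → WALT Γ Δ E M A → WALT Γ' Δ E M A
  ex-Δ : ∀ {Γ Δ Δ' E M A} → Δ ↭ Δ' → WALT Γ Δ E M A → WALT Γ Δ' E M A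
  ex-E : ∀ {Γ Δ E E' M A} → E ↭ E' → WALT Γ Δ E M A → WALT Γ Δ E' M A
  ex-Θ : ∀ {Γ Δ E E' M A} →
       Pointwise (λ p q → (proj₁ p ↭ proj₁ q) × (proj₂ p ≡ proj₂ q)) E E' →
       WALT Γ Δ E M A → WALT Γ Δ E' M A
  drop∅ : ∀ {Γ Δ E M A} → WALT Γ Δ (([] , nothing) ∷ E) M A → WALT Γ Δ E M A
  add∅ : ∀ {Γ Δ E M A} → WF Γ Δ (([] , nothing) ∷ E) →
       WALT Γ Δ E M A → WALT Γ Δ (([] , nothing) ∷ E) M A

data FTy : Set where
  fv  : ℕ → FTy
  _⇒_ : FTy → FTy → FTy
  ∀F  : FTy → FTy

shiftF : ℕ → FTy → FTy
shiftF c (fv n)  = if n <ᵇ c then fv n else fv (suc n)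
shiftF c (A ⇒ B) = shiftF c A ⇒ shiftF c B
shiftF c (∀F A)  = ∀F (shiftF (suc c) A)

substF : ℕ → FTy → FTy → FTy
substF j B (fv n)   = if n ≡ᵇ j then B else (if j <ᵇ n then fv (pred n) else fv n)
substF j B (A ⇒ A') = substF j B A ⇒ substF j B A'
substF j B (∀F A)   = ∀F (substF (suc j) (shiftF 0 B) A)

FCtx : Set
FCtx = List (ℕ × FTy)

lookupF : FCtx → ℕ → Maybe FTy
lookupF []            x = nothing
lookupF ((y , A) ∷ Γ) x = if x ≡ᵇ y then just A else lookupF Γ x

data _⊢F_∶_ : FCtx → Term → FTy → Set where
  Fvar  : ∀ {Γ x A} → lookupF Γ x ≡ just A → Γ ⊢F var x ∶ A
  Flam  : ∀ {Γ x A M B} → ((x , A) ∷ Γ) ⊢F M ∶ B → Γ ⊢F lam x M ∶ (A ⇒ B)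
  Fapp  : ∀ {Γ M N A B} → Γ ⊢F M ∶ (A ⇒ B) → Γ ⊢F N ∶ A → Γ ⊢F app M N ∶ B
  Fgen  : ∀ {Γ M A} → map (map₂ (shiftF 0)) Γ ⊢F M ∶ A → Γ ⊢F M ∶ ∀F A
  Finst : ∀ {Γ M A} (B : FTy) → Γ ⊢F M ∶ ∀F A → Γ ⊢F M ∶ substF 0 B A

eraseT : Ty → FTy
eraseL : Lin → FTy
eraseT (lin L) = eraseL L
eraseT (! A)   = eraseT A
eraseT ($ A)   = eraseT A
eraseL (tv n)   = fv n
eraseL (A ⊸ B)  = eraseT A ⇒ eraseT B
eraseL (A ⊸e B) = eraseT A ⇒ eraseT B
eraseL (∀L L)   = ∀F (eraseL L)

eraseCtx : Ctx → FCtx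
eraseCtx = map (map₂ eraseT)

ctxF : Ctx → Ctx → ECtx → FCtx
ctxF Γ Δ E = eraseCtx (Γ ++ Δ ++ flatE E)

module Submission where

-- Erasing ! and $ and reading ⊸ and ⊸e as ⇒ turns every WALT rule into a
-- System F rule, provided the System F context contains the erasure of every
-- assignment of Γ, Δ and of the pairs (Θ;Φ) of ℰ.  The theorem is proved by
-- induction on the WALT derivation: each rule is simulated by its System F
-- counterpart after re-typing the premises in the context of the conclusion.
-- Re-typing works because a well formed context has pairwise distinct
-- variables, so its erasure gives each variable the type it carries there.

open import Defs
open import Data.Nat using (ℕ; suc; _≡ᵇ_; _<ᵇ_; _≤_; z≤n; s≤s)
open import Data.Nat.Properties using (≡ᵇ⇒≡; ≡⇒≡ᵇ; ≤-trans; ≤-refl; n≤1+n; 1+n≰n)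
open import Data.Bool using (Bool; true; false; _∧_; _∨_; not; T; if_then_else_)
open import Data.Bool.Properties using (T-≡)
open import Data.Bool.ListAction using (any)
open import Data.Maybe using (just; nothing; is-just; fromMaybe)
import Data.Maybe as Maybe
open import Data.Maybe.Properties using (just-injective)
open import Data.List using (List; []; _∷_; _++_; map; filterᵇ; length; foldl; [_])
open import Data.List.Properties using (map-++)
open import Data.List.Membership.Propositional using (_∈_; _∉_)
open import Data.List.Membership.Propositional.Properties
  using (∈-++⁺ˡ; ∈-++⁺ʳ; ∈-++⁻; ∈-map⁺; ∈-filter⁺)
open import Data.List.Relation.Binary.Subset.Propositional using (_⊆_)
open import Data.List.Relation.Binary.Subset.Propositional.Properties
  using (⊆-refl; ⊆-trans; ⊆-reflexive-↭; xs⊆xs++ys; xs⊆ys++xs; ++⁺; ++⁺ʳ; ∷⁺ʳ)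
open import Data.List.Relation.Binary.Permutation.Propositional using (_↭_; ↭-refl; ↭-trans; ↭⇒↭ₛ)
import Data.List.Relation.Binary.Permutation.Propositional.Properties as ↭
open import Relation.Binary.PropositionalEquality
  using (_≡_; _≢_; refl; sym; trans; cong; cong₂; subst; ≢-sym; setoid; module ≡-Reasoning)
open import Data.List.Relation.Binary.Permutation.Setoid.Properties (setoid ℕ)
  using (Unique-resp-↭)
open import Data.List.Relation.Binary.Pointwise using (Pointwise; []; _∷_)
import Data.List.Relation.Unary.All as All
open import Data.List.Relation.Unary.Any using (here; there)
open import Data.List.Relation.Unary.AllPairs using (_∷_)
open import Data.List.Relation.Unary.Unique.Propositional using (Unique)
open import Data.Product using (∃-syntax; _×_; _,_; proj₁; proj₂; map₂)
open import Data.Sum using (inj₁; inj₂; [_,_]′)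
open import Data.Empty using (⊥-elim)
open import Data.Unit using (tt)
open import Function using (_∘_; Equivalence)

≡ᵇ-true : ∀ {m n} → (m ≡ᵇ n) ≡ true → m ≡ n
≡ᵇ-true {m} {n} e = ≡ᵇ⇒≡ m n (Equivalence.from T-≡ e)

≡ᵇ-false : ∀ {m n} → (m ≡ᵇ n) ≡ false → m ≢ n
≡ᵇ-false {m} e refl = subst T e (≡⇒≡ᵇ m m refl)

≡ᵇ-refl : ∀ n → (n ≡ᵇ n) ≡ true
≡ᵇ-refl n = Equivalence.to T-≡ (≡⇒≡ᵇ n n refl)

≢⇒≡ᵇ-false : ∀ {m n} → m ≢ n → (m ≡ᵇ n) ≡ false
≢⇒≡ᵇ-false {m} {n} m≢n with m ≡ᵇ n in e
... | true  = ⊥-elim (m≢n (≡ᵇ-true e))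
... | false = refl

∧-true : ∀ {a b} → (a ∧ b) ≡ true → (a ≡ true) × (b ≡ true)
∧-true {true} e = refl , e

eqT-sound : ∀ A B → eqT A B ≡ true → A ≡ B
eqL-sound : ∀ L L' → eqL L L' ≡ true → L ≡ L'
eqT-sound (lin L) (lin L') e = cong lin (eqL-sound L L' e)
eqT-sound (lin _) (! _) ()
eqT-sound (lin _) ($ _) ()
eqT-sound (! _) (lin _) ()
eqT-sound (! A) (! B) e = cong !_ (eqT-sound A B e)
eqT-sound (! _) ($ _) ()
eqT-sound ($ _) (lin _) ()
eqT-sound ($ _) (! _) ()
eqT-sound ($ A) ($ B) e = cong $_ (eqT-sound A B e)
eqL-sound (tv n) (tv m) e = cong tv (≡ᵇ-true e)
eqL-sound (tv _) (_ ⊸ _) ()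
eqL-sound (tv _) (_ ⊸e _) ()
eqL-sound (tv _) (∀L _) ()
eqL-sound (_ ⊸ _) (tv _) ()
eqL-sound (A ⊸ B) (A' ⊸ B') e with ∧-true {eqT A A'} e
... | eA , eB = cong₂ _⊸_ (eqT-sound A A' eA) (eqT-sound B B' eB)
eqL-sound (_ ⊸ _) (_ ⊸e _) ()
eqL-sound (_ ⊸ _) (∀L _) ()
eqL-sound (_ ⊸e _) (tv _) ()
eqL-sound (_ ⊸e _) (_ ⊸ _) ()
eqL-sound (A ⊸e B) (A' ⊸e B') e with ∧-true {eqT A A'} e
... | eA , eB = cong₂ _⊸e_ (eqT-sound A A' eA) (eqT-sound B B' eB)
eqL-sound (_ ⊸e _) (∀L _) ()
eqL-sound (∀L _) (tv _) ()
eqL-sound (∀L _) (_ ⊸ _) ()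
eqL-sound (∀L _) (_ ⊸e _) ()
eqL-sound (∀L L) (∀L L') e = cong ∀L (eqL-sound L L' e)

eqT-refl : ∀ A → eqT A A ≡ true
eqL-refl : ∀ L → eqL L L ≡ true
eqT-refl (lin L) = eqL-refl L
eqT-refl (! A) = eqT-refl A
eqT-refl ($ A) = eqT-refl A
eqL-refl (tv n) = ≡ᵇ-refl n
eqL-refl (A ⊸ B) rewrite eqT-refl A = eqT-refl B
eqL-refl (A ⊸e B) rewrite eqT-refl A = eqT-refl B
eqL-refl (∀L L) = eqL-refl L

eqΦ-sound : ∀ Φ Φ' → eqΦ Φ Φ' ≡ true → Φ ≡ Φ'
eqΦ-sound nothing nothing e = refl
eqΦ-sound (just (x , A)) (just (y , B)) e with ∧-true {x ≡ᵇ y} e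
... | ex , eA = cong just (cong₂ _,_ (≡ᵇ-true ex) (eqT-sound A B eA))

eqΦ-refl : ∀ Φ → eqΦ Φ Φ ≡ true
eqΦ-refl nothing = refl
eqΦ-refl (just (x , A)) rewrite ≡ᵇ-refl x = eqT-refl A

_≼_ : FCtx → FCtx → Set
G ≼ G' = ∀ {w D} → lookupF G w ≡ just D → lookupF G' w ≡ just D

shiftFCtx : FCtx → FCtx
shiftFCtx = map (map₂ (shiftF 0))

lookup-shift⁺ : ∀ G {w D} → lookupF G w ≡ just D → lookupF (shiftFCtx G) w ≡ just (shiftF 0 D)
lookup-shift⁺ ((y , C) ∷ G) {w} e with w ≡ᵇ y
... | true  = cong (Maybe.map (shiftF 0)) e
... | false = lookup-shift⁺ G e

lookup-shift⁻ : ∀ G {w D} → lookupF (shiftFCtx G) w ≡ just D →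
  ∃[ D' ] lookupF G w ≡ just D' × shiftF 0 D' ≡ D
lookup-shift⁻ ((y , C) ∷ G) {w} e with w ≡ᵇ y
... | true  = C , refl , just-injective e
... | false = lookup-shift⁻ G e

≼-shift : ∀ {G G'} → G ≼ G' → shiftFCtx G ≼ shiftFCtx G'
≼-shift {G} {G'} G≼G' e with lookup-shift⁻ G e
... | D' , e' , refl = lookup-shift⁺ G' (G≼G' e')

≼-bind : ∀ {G G'} x A → G ≼ G' → ((x , A) ∷ G) ≼ ((x , A) ∷ G')
≼-bind x A G≼G' {w} e with w ≡ᵇ x
... | true  = e
... | false = G≼G' e

weaken : ∀ {G G' M A} → G ≼ G' → G ⊢F M ∶ A → G' ⊢F M ∶ A
weaken G≼G' (Fvar e) = Fvar (G≼G' e)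
weaken {G} {G'} G≼G' (Flam {x = x} {A = A} d) = Flam (weaken (≼-bind {G} {G'} x A G≼G') d)
weaken G≼G' (Fapp d d') = Fapp (weaken G≼G' d) (weaken G≼G' d')
weaken {G} {G'} G≼G' (Fgen d) = Fgen (weaken (≼-shift {G} {G'} G≼G') d)
weaken G≼G' (Finst B d) = Finst B (weaken G≼G' d)

isIn : List ℕ → ℕ → Bool
isIn xs w = any (λ v → v ≡ᵇ w) xs

without : ℕ → List ℕ → List ℕ
without w = filterᵇ (λ v → not (v ≡ᵇ w))

isIn-without-self : ∀ xs w → isIn (without w xs) w ≡ false
isIn-without-self [] w = refl
isIn-without-self (v ∷ xs) w with v ≡ᵇ w in e
... | true  = isIn-without-self xs w
... | false rewrite e = isIn-without-self xs w

isIn-without-other : ∀ xs {u w} → u ≢ w → isIn (without w xs) u ≡ isIn xs u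
isIn-without-other [] u≢w = refl
isIn-without-other (v ∷ xs) {u} {w} u≢w with v ≡ᵇ w in e
... | true with refl ← ≡ᵇ-true {v} {w} e rewrite ≢⇒≡ᵇ-false (≢-sym u≢w) = isIn-without-other xs u≢w
... | false = cong ((v ≡ᵇ u) ∨_) (isIn-without-other xs u≢w)

Renames : List ℕ → ℕ → FCtx → FCtx → Set
Renames xs z G G' = ∀ {w D} → lookupF G w ≡ just D →
  lookupF G' (if isIn xs w then z else w) ≡ just D

Renames-shift : ∀ {xs z G G'} → Renames xs z G G' → Renames xs z (shiftFCtx G) (shiftFCtx G')
Renames-shift {G = G} {G'} ren e with lookup-shift⁻ G e
... | D' , e' , refl = lookup-shift⁺ G' (ren e')

Renames-bind : ∀ {xs z G G'} x A → z ≢ x → Renames xs z G G' →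
  Renames (without x xs) z ((x , A) ∷ G) ((x , A) ∷ G')
Renames-bind {xs} {z} x A z≢x ren {w} e with w ≡ᵇ x in w≡ᵇx
... | true with refl ← ≡ᵇ-true {w} {x} w≡ᵇx rewrite isIn-without-self xs x | ≡ᵇ-refl x = e
... | false rewrite isIn-without-other xs (≡ᵇ-false {w} {x} w≡ᵇx) with isIn xs w | ren e
...   | true  | e' rewrite ≢⇒≡ᵇ-false z≢x = e'
...   | false | e' rewrite w≡ᵇx = e'

rename : ∀ {G G' M B xs z} → Renames xs z G G' → z ∉ BV M → G ⊢F M ∶ B → G' ⊢F ren xs z M ∶ B
rename {xs = xs} ren z∉ (Fvar {x = w} e) with isIn xs w | ren e
... | true  | e' = Fvar e'
... | false | e' = Fvar e'
rename {G} {G'} {xs = xs} {z} ren z∉ (Flam {x = w} {A = A} d) =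
  Flam (rename (Renames-bind {xs} {z} {G} {G'} w A (z∉ ∘ here) ren) (z∉ ∘ there) d)
rename ren z∉ (Fapp {M = M} d d') =
  Fapp (rename ren (z∉ ∘ ∈-++⁺ˡ) d) (rename ren (z∉ ∘ ∈-++⁺ʳ (BV M)) d')
rename {G} {G'} {xs = xs} {z} ren z∉ (Fgen d) =
  Fgen (rename (Renames-shift {xs} {z} {G} {G'} ren) z∉ d)
rename ren z∉ (Finst B d) = Finst B (rename ren z∉ d)

allAsg : Ctx → Ctx → ECtx → Ctx
allAsg Γ Δ E = Γ ++ Δ ++ flatE E

keys : Ctx → List ℕ
keys = map proj₁

Distinct : Ctx → Set
Distinct P = Unique (keys P)

∈-keys : ∀ {w B P} → (w , B) ∈ P → w ∈ keys P
∈-keys = ∈-map⁺ proj₁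

Distinct-++ʳ : ∀ P {Q} → Distinct (P ++ Q) → Distinct Q
Distinct-++ʳ [] d = d
Distinct-++ʳ (_ ∷ P) (_ ∷ d) = Distinct-++ʳ P d

Distinct-disjoint : ∀ P {Q w} → Distinct (P ++ Q) → w ∈ keys P → w ∉ keys Q
Distinct-disjoint (_ ∷ P) {Q} (fresh ∷ _) (here refl) m =
  All.lookup fresh (subst (_ ∈_) (sym (map-++ proj₁ P Q)) (∈-++⁺ʳ (keys P) m)) refl
Distinct-disjoint (_ ∷ P) (_ ∷ d) (there m) = Distinct-disjoint P d m

sameType : ∀ {P w B B'} → Distinct P → (w , B) ∈ P → (w , B') ∈ P → B ≡ B'
sameType _ (here refl) (here refl) = refl
sameType (fresh ∷ _) (here refl) (there m') = ⊥-elim (All.lookup fresh (∈-keys m') refl)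
sameType (fresh ∷ _) (there m) (here refl) = ⊥-elim (All.lookup fresh (∈-keys m) refl)
sameType (_ ∷ d) (there m) (there m') = sameType d m m'

lookup-complete : ∀ {P w B} → Distinct P → (w , B) ∈ P → lookupF (eraseCtx P) w ≡ just (eraseT B)
lookup-complete {(y , C) ∷ P} {w} _ m with w ≡ᵇ y in e
lookup-complete (_ ∷ _) (here refl) | true = refl
lookup-complete (fresh ∷ _) (there m) | true = ⊥-elim (All.lookup fresh (∈-keys m) (sym (≡ᵇ-true e)))
lookup-complete {w = w} _ (here refl) | false = ⊥-elim (≡ᵇ-false {w} e refl)
lookup-complete (_ ∷ d) (there m) | false = lookup-complete d m

lookup-sound : ∀ P {w D} → lookupF (eraseCtx P) w ≡ just D → ∃[ B ] (w , B) ∈ P × eraseT B ≡ D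
lookup-sound ((y , C) ∷ P) {w} e with w ≡ᵇ y in w≡ᵇy
... | true with refl ← ≡ᵇ-true {w} {y} w≡ᵇy = C , here refl , just-injective e
... | false with lookup-sound P e
...   | B , m , eB = B , there m , eB

Realises : Ctx → FCtx → Set
Realises P G = ∀ {w B} → (w , B) ∈ P → lookupF G w ≡ just (eraseT B)

retype : ∀ {P G M T} → Realises P G → eraseCtx P ⊢F M ∶ T → G ⊢F M ∶ T
retype {P} {G} realises = weaken extends
  where
  extends : eraseCtx P ≼ G
  extends e with lookup-sound P e
  ... | B , m , refl = realises m

transport : ∀ {P C M T} → Distinct C → P ⊆ C → eraseCtx P ⊢F M ∶ T → eraseCtx C ⊢F M ∶ T
transport dC P⊆C = retype (lookup-complete dC ∘ P⊆C)

drop-head : ∀ {w v B A} {C : Ctx} → (w , B) ∈ (v , A) ∷ C → w ≢ v → (w , B) ∈ C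
drop-head (here refl) w≢v = ⊥-elim (w≢v refl)
drop-head (there m) _ = m

transport-bind : ∀ {P C x A M T} → Distinct P → Distinct C → (x , A) ∈ P → P ⊆ (x , A) ∷ C →
  eraseCtx P ⊢F M ∶ T → eraseCtx C ⊢F lam x M ∶ (eraseT A ⇒ T)
transport-bind {P} {C} {x} {A} dP dC xA∈P P⊆xC = Flam ∘ retype realises
  where
  realises : Realises P (eraseCtx ((x , A) ∷ C))
  realises {w} m with w ≡ᵇ x in w≡ᵇx
  ... | true with refl ← ≡ᵇ-true {w} {x} w≡ᵇx = cong (just ∘ eraseT) (sameType dP xA∈P m)
  ... | false = lookup-complete dC (drop-head (P⊆xC m) (≡ᵇ-false w≡ᵇx))

join : ∀ {X Y Z : Ctx} → X ⊆ Z → Y ⊆ Z → X ++ Y ⊆ Z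
join {X} X⊆Z Y⊆Z m = [ X⊆Z , Y⊆Z ]′ (∈-++⁻ X m)

front : ∀ Z W {X Y : Ctx} → X ⊆ W ++ Y → Z ++ X ⊆ W ++ Z ++ Y
front Z W X⊆WY = ⊆-trans (++⁺ʳ Z X⊆WY) (⊆-reflexive-↭ (↭.shifts Z W))

pair : EPair → Ctx
pair (Θ , Φ) = Θ ++ maybeToList Φ

flatE-∈⁻ : ∀ E {a} → a ∈ flatE E → ∃[ p ] p ∈ E × a ∈ pair p
flatE-∈⁻ (p ∷ E) m with ∈-++⁻ (pair p) m
... | inj₁ m' = p , here refl , m'
... | inj₂ m' with flatE-∈⁻ E m'
...   | q , q∈E , a∈q = q , there q∈E , a∈q

flatE-∈⁺ : ∀ {E p a} → p ∈ E → a ∈ pair p → a ∈ flatE E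
flatE-∈⁺ (here refl) m = ∈-++⁺ˡ m
flatE-∈⁺ {q ∷ E} (there p∈E) m = ∈-++⁺ʳ (pair q) (flatE-∈⁺ p∈E m)

Keyed : ECtx → Set
Keyed E = ∀ {Θ Φ} → (Θ , Φ) ∈ E → findΘ Φ E ≡ just Θ

Keyed-single : ∀ q → Keyed [ q ]
Keyed-single (Θ , Φ) (here refl) rewrite eqΦ-refl Φ = refl

findΘ-sound : ∀ E {Φ Θ} → findΘ Φ E ≡ just Θ → (Θ , Φ) ∈ E
findΘ-sound ((Θ' , Φ') ∷ E) {Φ} e with eqΦ Φ Φ' in eΦ
... | true rewrite eqΦ-sound Φ Φ' eΦ | just-injective e = here refl
... | false = there (findΘ-sound E e)

merge : ECtx → EPair → EPair
merge EN (Θ , Φ) = (Θ ++ fromMaybe [] (findΘ Φ EN) , Φ)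

⊔-⊆ˡ : ∀ EM EN → flatE EM ⊆ flatE (EM ⊔ EN)
⊔-⊆ˡ EM EN m with flatE-∈⁻ EM m
... | (Θ , Φ) , p∈EM , a∈p =
  flatE-∈⁺ (∈-++⁺ˡ (∈-map⁺ (merge EN) p∈EM))
    ([ ∈-++⁺ˡ ∘ ∈-++⁺ˡ , ∈-++⁺ʳ (Θ ++ _) ]′ (∈-++⁻ Θ a∈p))

-- A pair of EN either survives unchanged in EM ⊔ EN or is merged into the
-- pair of EM with the same Φ; the latter needs EN to be Keyed.
⊔-⊆ʳ : ∀ EM EN → Keyed EN → flatE EN ⊆ flatE (EM ⊔ EN)
⊔-⊆ʳ EM EN keyed m with flatE-∈⁻ EN m
... | (Θ , Φ) , p∈EN , a∈p with findΘ Φ EM in found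
...   | nothing =
  flatE-∈⁺ (∈-++⁺ʳ (map (merge EN) EM)
    (∈-filter⁺ _ p∈EN (subst (T ∘ not ∘ is-just) (sym found) tt))) a∈p
...   | just Θq =
  flatE-∈⁺ (∈-++⁺ˡ (∈-map⁺ (merge EN) (findΘ-sound EM found)))
    (subst (λ F → _ ∈ (Θq ++ fromMaybe [] F) ++ maybeToList Φ) (sym (keyed p∈EN))
      ([ ∈-++⁺ˡ ∘ ∈-++⁺ʳ Θq , ∈-++⁺ʳ (Θq ++ Θ) ]′ (∈-++⁻ Θ a∈p)))

⊔-single : ∀ E q → pair q ⊆ flatE (E ⊔ [ q ])
⊔-single E q = ⊔-⊆ʳ E [ q ] (Keyed-single q) ∘ ∈-++⁺ˡ

foldl-⊔-acc : ∀ Ps acc → flatE acc ⊆ flatE (foldl _⊔_ acc (map [_] Ps))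
foldl-⊔-acc [] acc = ⊆-refl
foldl-⊔-acc (p ∷ Ps) acc = foldl-⊔-acc Ps (acc ⊔ [ p ]) ∘ ⊔-⊆ˡ acc [ p ]

foldl-⊔-new : ∀ Ps acc → flatE Ps ⊆ flatE (foldl _⊔_ acc (map [_] Ps))
foldl-⊔-new (p ∷ Ps) acc m with ∈-++⁻ (pair p) m
... | inj₁ m' = foldl-⊔-acc Ps (acc ⊔ [ p ]) (⊔-single acc p m')
... | inj₂ m' = foldl-⊔-new Ps (acc ⊔ [ p ]) m'

nothings : ECtx → ℕ
nothings E = length (filterᵇ (λ p → isNothing (proj₂ p)) E)

nothings-tail : ∀ p E → nothings E ≤ nothings (p ∷ E)
nothings-tail (_ , nothing) E = n≤1+n _
nothings-tail (_ , just _) E = ≤-refl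

nothings-∈ : ∀ {E Θ} → (Θ , nothing) ∈ E → 1 ≤ nothings E
nothings-∈ (here refl) = s≤s z≤n
nothings-∈ {(_ , nothing) ∷ E} (there m) = s≤s z≤n
nothings-∈ {(_ , just _) ∷ E} (there m) = nothings-∈ m

-- Two pairs with the same Φ = {a} would repeat a; two with Φ = ∅ are
-- excluded by the count.
WF⇒Keyed : ∀ E → Distinct (flatE E) → nothings E ≤ 1 → Keyed E
WF⇒Keyed ((Θ₁ , Φ₁) ∷ E) _ _ (here refl) rewrite eqΦ-refl Φ₁ = refl
WF⇒Keyed ((Θ₁ , Φ₁) ∷ E) d n {Θ} {Φ} (there m) with eqΦ Φ Φ₁ in eΦ
... | false = WF⇒Keyed E (Distinct-++ʳ (pair (Θ₁ , Φ₁)) d) (≤-trans (nothings-tail (Θ₁ , Φ₁) E) n) m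
... | true with eqΦ-sound Φ Φ₁ eΦ
WF⇒Keyed ((Θ₁ , just a) ∷ E) d _ {Θ} (there m) | true | refl =
  ⊥-elim (Distinct-disjoint (pair (Θ₁ , just a)) d (∈-keys (∈-++⁺ʳ Θ₁ (here refl)))
    (∈-keys (flatE-∈⁺ m (∈-++⁺ʳ Θ (here refl)))))
WF⇒Keyed ((Θ₁ , nothing) ∷ E) _ (s≤s n) (there m) | true | refl =
  ⊥-elim (1+n≰n (≤-trans (nothings-∈ m) n))

nothings-↭ : ∀ {E E'} → E ↭ E' → nothings E ≡ nothings E'
nothings-↭ p = ↭.↭-length (↭.filter-↭ _ p)

SameΦ : ECtx → ECtx → Set
SameΦ = Pointwise (λ p q → (proj₁ p ↭ proj₁ q) × (proj₂ p ≡ proj₂ q))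

nothings-SameΦ : ∀ {E E'} → SameΦ E E' → nothings E ≡ nothings E'
nothings-SameΦ [] = refl
nothings-SameΦ {(_ , nothing) ∷ _} ((_ , refl) ∷ r) = cong suc (nothings-SameΦ r)
nothings-SameΦ {(_ , just _) ∷ _} ((_ , refl) ∷ r) = nothings-SameΦ r

flatE-↭ : ∀ {E E'} → E ↭ E' → flatE E ↭ flatE E'
flatE-↭ _↭_.refl = ↭-refl
flatE-↭ (_↭_.prep p r) = ↭.++⁺ˡ (pair p) (flatE-↭ r)
flatE-↭ (_↭_.swap p q r) =
  ↭-trans (↭.shifts (pair p) (pair q)) (↭.++⁺ˡ (pair q) (↭.++⁺ˡ (pair p) (flatE-↭ r)))
flatE-↭ (_↭_.trans r r') = ↭-trans (flatE-↭ r) (flatE-↭ r')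

flatE-SameΦ : ∀ {E E'} → SameΦ E E' → flatE E ↭ flatE E'
flatE-SameΦ [] = ↭-refl
flatE-SameΦ {(_ , Φ) ∷ _} ((Θ↭Θ' , refl) ∷ r) =
  ↭.++⁺ (↭.++⁺ʳ (maybeToList Φ) Θ↭Θ') (flatE-SameΦ r)

reorder-Γ : ∀ {Γ Γ'} Δ E → Γ ↭ Γ' → allAsg Γ Δ E ↭ allAsg Γ' Δ E
reorder-Γ Δ E = ↭.++⁺ʳ (Δ ++ flatE E)

reorder-Δ : ∀ Γ {Δ Δ'} E → Δ ↭ Δ' → allAsg Γ Δ E ↭ allAsg Γ Δ' E
reorder-Δ Γ E = ↭.++⁺ˡ Γ ∘ ↭.++⁺ʳ (flatE E)

reorder-E : ∀ Γ Δ E E' → flatE E ↭ flatE E' → allAsg Γ Δ E ↭ allAsg Γ Δ E'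
reorder-E Γ Δ _ _ = ↭.++⁺ˡ Γ ∘ ↭.++⁺ˡ Δ

Distinct-↭ : ∀ {P Q} → P ↭ Q → Distinct P → Distinct Q
Distinct-↭ P↭Q = Unique-resp-↭ (↭⇒↭ₛ (↭.map⁺ proj₁ P↭Q))

wf : ∀ {Γ Δ E M A} → WALT Γ Δ E M A → WF Γ Δ E
wf (ax w) = w
wf (contr _ _ w) = w
wf (⊸I _ w) = w
wf (⊸I$ _ w) = w
wf (⊸E _ _ _ w) = w
wf (⊸I! _ w) = w
wf (⊸E! _ _ _ w) = w
wf (⊸eI _ w) = w
wf (⊸eE _ _ _ w) = w
wf ($R _ _ _ _ _ _ w) = w
wf (!R _ _ _ _ _ _ _ w) = w
wf (∀I _ w) = w
wf (∀E _ d) = wf d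
wf (ex-Γ {Δ = Δ} {E = E} p d) = Distinct-↭ (reorder-Γ Δ E p) (proj₁ (wf d)) , proj₂ (wf d)
wf (ex-Δ {Γ = Γ} {E = E} p d) = Distinct-↭ (reorder-Δ Γ E p) (proj₁ (wf d)) , proj₂ (wf d)
wf (ex-E {Γ} {Δ} {E} {E'} p d) =
  Distinct-↭ (reorder-E Γ Δ E E' (flatE-↭ p)) (proj₁ (wf d)) ,
  subst (_≤ 1) (nothings-↭ p) (proj₂ (wf d))
wf (ex-Θ {Γ} {Δ} {E} {E'} r d) =
  Distinct-↭ (reorder-E Γ Δ E E' (flatE-SameΦ r)) (proj₁ (wf d)) ,
  subst (_≤ 1) (nothings-SameΦ r) (proj₂ (wf d))
wf (drop∅ {E = E} d) = proj₁ (wf d) , ≤-trans (nothings-tail ([] , nothing) E) (proj₂ (wf d))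
wf (add∅ w _) = w

keyed : ∀ {Γ Δ E M A} → WALT Γ Δ E M A → Keyed E
keyed {Γ} {Δ} {E} d = WF⇒Keyed E (Distinct-++ʳ Δ (Distinct-++ʳ Γ (proj₁ (wf d)))) (proj₂ (wf d))

erase-shiftT : ∀ c A → eraseT (shiftT c A) ≡ shiftF c (eraseT A)
erase-shiftL : ∀ c L → eraseL (shiftL c L) ≡ shiftF c (eraseL L)
erase-shiftT c (lin L) = erase-shiftL c L
erase-shiftT c (! A) = erase-shiftT c A
erase-shiftT c ($ A) = erase-shiftT c A
erase-shiftL c (tv n) with n <ᵇ c
... | true  = refl
... | false = refl
erase-shiftL c (A ⊸ B) = cong₂ _⇒_ (erase-shiftT c A) (erase-shiftT c B)
erase-shiftL c (A ⊸e B) = cong₂ _⇒_ (erase-shiftT c A) (erase-shiftT c B)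
erase-shiftL c (∀L L) = cong ∀F (erase-shiftL (suc c) L)

erase-substT : ∀ j L' A → eraseT (substT j L' A) ≡ substF j (eraseL L') (eraseT A)
erase-substL : ∀ j L' L → eraseL (substL j L' L) ≡ substF j (eraseL L') (eraseL L)
erase-substT j L' (lin L) = erase-substL j L' L
erase-substT j L' (! A) = erase-substT j L' A
erase-substT j L' ($ A) = erase-substT j L' A
erase-substL j L' (tv n) with n ≡ᵇ j
... | true = refl
... | false with j <ᵇ n
...   | true  = refl
...   | false = refl
erase-substL j L' (A ⊸ B) = cong₂ _⇒_ (erase-substT j L' A) (erase-substT j L' B)
erase-substL j L' (A ⊸e B) = cong₂ _⇒_ (erase-substT j L' A) (erase-substT j L' B)
erase-substL j L' (∀L L) = begin
  ∀F (eraseL (substL (suc j) (shiftL 0 L') L))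
    ≡⟨ cong ∀F (erase-substL (suc j) (shiftL 0 L') L) ⟩
  ∀F (substF (suc j) (eraseL (shiftL 0 L')) (eraseL L))
    ≡⟨ cong (λ T → ∀F (substF (suc j) T (eraseL L))) (erase-shiftL 0 L') ⟩
  ∀F (substF (suc j) (shiftF 0 (eraseL L')) (eraseL L)) ∎
  where open ≡-Reasoning

flatE-shift : ∀ E → flatE (shiftE E) ≡ shiftC (flatE E)
flatE-shift [] = refl
flatE-shift ((a ∷ Θ , Φ) ∷ E) = cong (_ ∷_) (flatE-shift ((Θ , Φ) ∷ E))
flatE-shift (([] , nothing) ∷ E) = flatE-shift E
flatE-shift (([] , just a) ∷ E) = cong (_ ∷_) (flatE-shift E)

allAsg-shift : ∀ Γ Δ E → allAsg (shiftC Γ) (shiftC Δ) (shiftE E) ≡ shiftC (allAsg Γ Δ E)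
allAsg-shift (a ∷ Γ) Δ E = cong (_ ∷_) (allAsg-shift Γ Δ E)
allAsg-shift [] (a ∷ Δ) E = cong (_ ∷_) (allAsg-shift [] Δ E)
allAsg-shift [] [] E = flatE-shift E

erase-shiftC : ∀ P → eraseCtx (shiftC P) ≡ shiftFCtx (eraseCtx P)
erase-shiftC [] = refl
erase-shiftC ((x , A) ∷ P) = cong₂ _∷_ (cong (x ,_) (erase-shiftT 0 A)) (erase-shiftC P)

ctxF-shift : ∀ Γ Δ E → ctxF (shiftC Γ) (shiftC Δ) (shiftE E) ≡ shiftFCtx (ctxF Γ Δ E)
ctxF-shift Γ Δ E = trans (cong eraseCtx (allAsg-shift Γ Δ E)) (erase-shiftC (allAsg Γ Δ E))

erase-box : ∀ Γ Δ Θ → ctxF Γ Δ [ (Θ , nothing) ] ≡ ctxF Γ ($ctx Δ) [ ($ctx Θ , nothing) ]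
erase-box (a ∷ Γ) Δ Θ = cong (_ ∷_) (erase-box Γ Δ Θ)
erase-box [] (a ∷ Δ) Θ = cong (_ ∷_) (erase-box [] Δ Θ)
erase-box [] [] (a ∷ Θ) = cong (_ ∷_) (erase-box [] [] Θ)
erase-box [] [] [] = refl

contraction-renames : ∀ {P C x y z A} → Distinct P → Distinct C →
  (x , A) ∈ P → (y , A) ∈ P → (z , A) ∈ C → P ⊆ (x , A) ∷ (y , A) ∷ C →
  Renames (x ∷ y ∷ []) z (eraseCtx P) (eraseCtx C)
contraction-renames {P} {C} {x} {y} {z} {A} dP dC xA∈P yA∈P zA∈C P⊆ e with lookup-sound P e
... | B , m , refl = renamed m
  where
  renamed : ∀ {w B} → (w , B) ∈ P →
    lookupF (eraseCtx C) (if isIn (x ∷ y ∷ []) w then z else w) ≡ just (eraseT B)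
  renamed {w} m with x ≡ᵇ w in x≡ᵇw
  ... | true with refl ← ≡ᵇ-true {x} {w} x≡ᵇw rewrite sameType dP m xA∈P = lookup-complete dC zA∈C
  ... | false with y ≡ᵇ w in y≡ᵇw
  ...   | true with refl ← ≡ᵇ-true {y} {w} y≡ᵇw rewrite sameType dP m yA∈P = lookup-complete dC zA∈C
  ...   | false = lookup-complete dC
    (drop-head (drop-head (P⊆ m) (≢-sym (≡ᵇ-false {x} x≡ᵇw))) (≢-sym (≡ᵇ-false {y} y≡ᵇw)))

pair⊆ : ∀ {Θ : Ctx} {a Y} → Θ ⊆ Y → Θ ++ [ a ] ⊆ a ∷ Y
pair⊆ {a = a} {Y} Θ⊆Y = join (there ∘ Θ⊆Y) (xs⊆xs++ys [ a ] Y)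

erase-contr : ∀ {Γ Δ E Θx Θy x y z A M B} →
  WALT Γ Δ ((Θx , just (x , A)) ∷ (Θy , just (y , A)) ∷ E) M B → z ∉ BV M →
  WF Γ Δ (E ⊔ [ (Θx ++ Θy , just (z , A)) ]) →
  ctxF Γ Δ ((Θx , just (x , A)) ∷ (Θy , just (y , A)) ∷ E) ⊢F M ∶ eraseT B →
  ctxF Γ Δ (E ⊔ [ (Θx ++ Θy , just (z , A)) ]) ⊢F ren (x ∷ y ∷ []) z M ∶ eraseT B
erase-contr {Γ} {Δ} {E} {Θx} {Θy} {x} {y} {z} {A} d z∉ wC =
  rename (contraction-renames (proj₁ (wf d)) (proj₁ wC) xA∈P yA∈P zA∈C (front Γ xy (front Δ xy pairs⊆)))
    z∉
  where
  q : EPair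
  q = (Θx ++ Θy , just (z , A))
  xy : Ctx
  xy = (x , A) ∷ (y , A) ∷ []
  xA∈P : (x , A) ∈ allAsg Γ Δ ((Θx , just (x , A)) ∷ (Θy , just (y , A)) ∷ E)
  xA∈P = ∈-++⁺ʳ Γ (∈-++⁺ʳ Δ (∈-++⁺ˡ (∈-++⁺ʳ Θx (here refl))))
  yA∈P : (y , A) ∈ allAsg Γ Δ ((Θx , just (x , A)) ∷ (Θy , just (y , A)) ∷ E)
  yA∈P = ∈-++⁺ʳ Γ (∈-++⁺ʳ Δ (∈-++⁺ʳ (Θx ++ [ (x , A) ]) (∈-++⁺ˡ (∈-++⁺ʳ Θy (here refl)))))
  zA∈C : (z , A) ∈ allAsg Γ Δ (E ⊔ [ q ])
  zA∈C = ∈-++⁺ʳ Γ (∈-++⁺ʳ Δ (⊔-single E q (∈-++⁺ʳ (Θx ++ Θy) (here refl))))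
  Θs⊆ : Θx ++ Θy ⊆ flatE (E ⊔ [ q ])
  Θs⊆ = ⊔-single E q ∘ xs⊆xs++ys (Θx ++ Θy) _
  pairs⊆ : flatE ((Θx , just (x , A)) ∷ (Θy , just (y , A)) ∷ E) ⊆ xy ++ flatE (E ⊔ [ q ])
  pairs⊆ = join (pair⊆ (there ∘ Θs⊆ ∘ xs⊆xs++ys Θx Θy))
    (there ∘ join (pair⊆ (Θs⊆ ∘ xs⊆ys++xs Θy Θx)) (there ∘ ⊔-⊆ˡ E [ q ]))

erase-⊸I$ : ∀ {Γ Δ E x A M B} → WALT Γ ((x , A) ∷ Δ) E M B → WF Γ Δ E →
  ctxF Γ ((x , A) ∷ Δ) E ⊢F M ∶ eraseT B → ctxF Γ Δ E ⊢F lam x M ∶ (eraseT A ⇒ eraseT B)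
erase-⊸I$ {Γ} {x = x} {A} d wC =
  transport-bind (proj₁ (wf d)) (proj₁ wC) (∈-++⁺ʳ Γ (here refl)) (front Γ [ (x , A) ] ⊆-refl)

erase-⊸I! : ∀ {Γ Δ E Θ x A M B} → WALT Γ Δ ((Θ , just (x , A)) ∷ E) M B →
  WF Γ Δ (E ⊔ [ (Θ , nothing) ]) → ctxF Γ Δ ((Θ , just (x , A)) ∷ E) ⊢F M ∶ eraseT B →
  ctxF Γ Δ (E ⊔ [ (Θ , nothing) ]) ⊢F lam x M ∶ (eraseT A ⇒ eraseT B)
erase-⊸I! {Γ} {Δ} {E} {Θ} {x} {A} d wC =
  transport-bind (proj₁ (wf d)) (proj₁ wC) (∈-++⁺ʳ Γ (∈-++⁺ʳ Δ (∈-++⁺ˡ (∈-++⁺ʳ Θ (here refl)))))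
    (front Γ [ (x , A) ] (front Δ [ (x , A) ]
      (join (pair⊆ (⊔-single E (Θ , nothing) ∘ xs⊆xs++ys Θ [])) (there ∘ ⊔-⊆ˡ E [ (Θ , nothing) ]))))

erase-⊸eI : ∀ {Γ Δ E Θ x A M B} → WALT Γ Δ (((x , A) ∷ Θ , nothing) ∷ E) M B →
  WF Γ Δ (E ⊔ [ (Θ , nothing) ]) → ctxF Γ Δ (((x , A) ∷ Θ , nothing) ∷ E) ⊢F M ∶ eraseT B →
  ctxF Γ Δ (E ⊔ [ (Θ , nothing) ]) ⊢F lam x M ∶ (eraseT A ⇒ eraseT B)
erase-⊸eI {Γ} {Δ} {E} {Θ} {x} {A} d wC =
  transport-bind (proj₁ (wf d)) (proj₁ wC) (∈-++⁺ʳ Γ (∈-++⁺ʳ Δ (here refl)))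
    (front Γ [ (x , A) ] (front Δ [ (x , A) ]
      (∷⁺ʳ (x , A) (join (⊔-single E (Θ , nothing)) (⊔-⊆ˡ E [ (Θ , nothing) ])))))

erase-app : ∀ {ΓM ΔM EM ΓN ΔN EN M N A B T} → WALT ΓN ΔN EN N T →
  WF (ΓM ++ ΓN) (ΔM ++ ΔN) (EM ⊔ EN) →
  ctxF ΓM ΔM EM ⊢F M ∶ (A ⇒ B) → ctxF ΓN ΔN EN ⊢F N ∶ A →
  ctxF (ΓM ++ ΓN) (ΔM ++ ΔN) (EM ⊔ EN) ⊢F app M N ∶ B
erase-app {ΓM} {ΔM} {EM} {ΓN} {ΔN} {EN} dN w tM tN =
  Fapp (transport (proj₁ w) (++⁺ (xs⊆xs++ys ΓM ΓN) (++⁺ (xs⊆xs++ys ΔM ΔN) (⊔-⊆ˡ EM EN))) tM)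
       (transport (proj₁ w)
         (++⁺ (xs⊆ys++xs ΓN ΓM) (++⁺ (xs⊆ys++xs ΔN ΔM) (⊔-⊆ʳ EM EN (keyed dN)))) tN)

erase-appₑ : ∀ {ΓM Δ EM EN M N A B T} → WALT [] [] EN N T → WF ΓM Δ (EM ⊔ EN) →
  ctxF ΓM Δ EM ⊢F M ∶ (A ⇒ B) → ctxF [] [] EN ⊢F N ∶ A → ctxF ΓM Δ (EM ⊔ EN) ⊢F app M N ∶ B
erase-appₑ {ΓM} {Δ} {EM} {EN} dN w tM tN =
  Fapp (transport (proj₁ w) (++⁺ʳ ΓM (++⁺ʳ Δ (⊔-⊆ˡ EM EN))) tM)
       (transport (proj₁ w) (xs⊆ys++xs _ ΓM ∘ xs⊆ys++xs _ Δ ∘ ⊔-⊆ʳ EM EN (keyed dN)) tN)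

erase-$ : ∀ {Γ Δ' Θ' M B} Γ' Δ Ps → Γ ⊆ Δ ++ flatE Ps →
  WF Γ' ($ctx Δ' ++ Δ) (foldl _⊔_ [ ($ctx Θ' , nothing) ] (map [_] Ps)) →
  ctxF Γ Δ' [ (Θ' , nothing) ] ⊢F M ∶ B →
  ctxF Γ' ($ctx Δ' ++ Δ) (foldl _⊔_ [ ($ctx Θ' , nothing) ] (map [_] Ps)) ⊢F M ∶ B
erase-$ {Γ} {Δ'} {Θ'} {M} {B} Γ' Δ Ps Γ⊆ w d =
  transport (proj₁ w) (xs⊆ys++xs _ Γ' ∘ join Γ-in (join Δ'-in Θ'-in))
    (subst (_⊢F M ∶ B) (erase-box Γ Δ' Θ') d)
  where
  acc : ECtx
  acc = [ ($ctx Θ' , nothing) ]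
  Γ-in : Γ ⊆ ($ctx Δ' ++ Δ) ++ flatE (foldl _⊔_ acc (map [_] Ps))
  Γ-in = ++⁺ (xs⊆ys++xs Δ ($ctx Δ')) (foldl-⊔-new Ps acc) ∘ Γ⊆
  Δ'-in : $ctx Δ' ⊆ ($ctx Δ' ++ Δ) ++ flatE (foldl _⊔_ acc (map [_] Ps))
  Δ'-in = xs⊆xs++ys _ _ ∘ xs⊆xs++ys ($ctx Δ') Δ
  Θ'-in : flatE acc ⊆ ($ctx Δ' ++ Δ) ++ flatE (foldl _⊔_ acc (map [_] Ps))
  Θ'-in = xs⊆ys++xs _ ($ctx Δ' ++ Δ) ∘ foldl-⊔-acc Ps acc

erase-! : ∀ {Γ Θ' M B} Γ' Δ Θ Φ → Γ ⊆ Θ ++ maybeToList Φ →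
  WF Γ' Δ ([ ($ctx Θ' , nothing) ] ⊔ [ (Θ , Φ) ]) →
  ctxF Γ [] [ (Θ' , nothing) ] ⊢F M ∶ B →
  ctxF Γ' Δ ([ ($ctx Θ' , nothing) ] ⊔ [ (Θ , Φ) ]) ⊢F M ∶ B
erase-! {Γ} {Θ'} {M} {B} Γ' Δ Θ Φ Γ⊆ w d =
  transport (proj₁ w)
    (xs⊆ys++xs _ Γ' ∘ xs⊆ys++xs _ Δ ∘
      join (⊔-single E₀ (Θ , Φ) ∘ Γ⊆) (⊔-⊆ˡ E₀ [ (Θ , Φ) ]))
    (subst (_⊢F M ∶ B) (erase-box Γ [] Θ') d)
  where
  E₀ : ECtx
  E₀ = [ ($ctx Θ' , nothing) ]

erase-∀E : ∀ {G M} L' L → G ⊢F M ∶ ∀F (eraseL L) → G ⊢F M ∶ eraseL (substL 0 L' L)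
erase-∀E {G} {M} L' L d = subst (G ⊢F M ∶_) (sym (erase-substL 0 L' L)) (Finst (eraseL L') d)

-- Induction on the derivation.  (⊸I), drop∅ and add∅ need no re-typing,
-- since their premise and conclusion have the same assignments up to the
-- abstracted one; the exchange rules re-type along the permutation.
mainTheorem1 : ∀ {Γ Δ E M A} → WALT Γ Δ E M A → ctxF Γ Δ E ⊢F M ∶ eraseT A
mainTheorem1 (ax {L = L} w) = Fvar (lookup-complete {B = lin L} (proj₁ w) (here refl))
mainTheorem1 (contr d z∉ w) = erase-contr d z∉ w (mainTheorem1 d)
mainTheorem1 (⊸I d _) = Flam (mainTheorem1 d)
mainTheorem1 (⊸I$ d w) = erase-⊸I$ d w (mainTheorem1 d)
mainTheorem1 (⊸E {ΓM} {ΔM} {EM} dM dN _ w) = erase-app {ΓM} {ΔM} {EM} dN w (mainTheorem1 dM) (mainTheorem1 dN)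
mainTheorem1 (⊸I! d w) = erase-⊸I! d w (mainTheorem1 d)
mainTheorem1 (⊸E! {ΓM} {ΔM} {EM} dM dN _ w) = erase-app {ΓM} {ΔM} {EM} dN w (mainTheorem1 dM) (mainTheorem1 dN)
mainTheorem1 (⊸eI d w) = erase-⊸eI d w (mainTheorem1 d)
mainTheorem1 (⊸eE {ΓM} {Δ} {EM} dM dN _ w) = erase-appₑ {ΓM} {Δ} {EM} dN w (mainTheorem1 dM) (mainTheorem1 dN)
mainTheorem1 ($R Γ' Δ Ps d _ Γ⊆ w) = erase-$ Γ' Δ Ps Γ⊆ w (mainTheorem1 d)
mainTheorem1 (!R Γ' Δ Θ Φ d Γ⊆ _ w) = erase-! Γ' Δ Θ Φ Γ⊆ w (mainTheorem1 d)
mainTheorem1 (∀I {Γ} {Δ} {E} {M} {L} d _) =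
  Fgen (subst (_⊢F M ∶ eraseL L) (ctxF-shift Γ Δ E) (mainTheorem1 d))
mainTheorem1 (∀E {L = L} L' d) = erase-∀E L' L (mainTheorem1 d)
mainTheorem1 D@(ex-Γ {Δ = Δ} {E = E} p d) =
  transport (proj₁ (wf D)) (⊆-reflexive-↭ (reorder-Γ Δ E p)) (mainTheorem1 d)
mainTheorem1 D@(ex-Δ {Γ = Γ} {E = E} p d) =
  transport (proj₁ (wf D)) (⊆-reflexive-↭ (reorder-Δ Γ E p)) (mainTheorem1 d)
mainTheorem1 D@(ex-E {Γ} {Δ} {E} {E'} p d) =
  transport (proj₁ (wf D)) (⊆-reflexive-↭ (reorder-E Γ Δ E E' (flatE-↭ p))) (mainTheorem1 d)
mainTheorem1 D@(ex-Θ {Γ} {Δ} {E} {E'} r d) =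
  transport (proj₁ (wf D)) (⊆-reflexive-↭ (reorder-E Γ Δ E E' (flatE-SameΦ r))) (mainTheorem1 d)
mainTheorem1 (drop∅ d) = mainTheorem1 d
mainTheorem1 (add∅ _ d) = mainTheorem1 d
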